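{- For every integer $n \geq 8$ with $n \neq 11$, Right wins the Forbidden Leaf Variant of the Mixed Deletion Game played on the cycle $C_n$ regardless of which player moves first.
   Context: The Classic Variant of the Mixed Deletion Game is a two-player combinatorial game between Left and Right played on a finite simple undirected graph; players alternate turns. On her turn Left deletes one vertex together with all edges incident to it; on his turn Right deletes one edge. The game ends when a deletion creates an isolated vertex (a vertex of degree $0$), and the player whose deletion created an isolated vertex loses; thus a legal move is a deletion which does not create an isolated vertex, and a player with no legal move loses. The Forbidden Leaf Variant has the same rules with the additional restriction that Left may not delete a leaf (a vertex of degree $1$). $C_n$ denotes the cycle graph on $n$ vertices. -}

module Defs where

open import Data.Bool using (Bool; true; false; _∧_; _∨_; not; if_then_else_)
open import Data.Nat using (ℕ; zero; suc; _≡ᵇ_; _<_)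
open import Data.Fin using (Fin; toℕ)
open import Data.List using (List; map; allFin)
open import Data.Nat.ListAction using (sum)
open import Data.Product using (Σ; _×_; _,_)
open import Relation.Binary.PropositionalEquality using (_≡_; _≢_)
open import Relation.Nullary using (¬_)

-- A position of the game: a subgraph of a graph on the vertex universe Fin n,
-- given by the set of present vertices and a (symmetric) edge relation.
-- Edges are only ever between present vertices (invariant maintained by the moves).
record Graph (n : ℕ) : Set where
  constructor mkGraph
  field
    vert : Fin n → Bool
    edge : Fin n → Fin n → Bool
open Graph public

_=ᶠ_ : ∀ {n} → Fin n → Fin n → Bool
i =ᶠ j = toℕ i ≡ᵇ toℕ j

deg : ∀ {n} → Graph n → Fin n → ℕ
deg {n} G i = sum (map (λ j → if edge G i j then 1 else 0) (allFin n))

NoIsolated : ∀ {n} → Graph n → Set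
NoIsolated G = ∀ i → vert G i ≡ true → 0 < deg G i

delVertex : ∀ {n} → Graph n → Fin n → Graph n
delVertex G v = mkGraph (λ x → vert G x ∧ not (x =ᶠ v))
                        (λ x y → edge G x y ∧ not (x =ᶠ v) ∧ not (y =ᶠ v))

delEdge : ∀ {n} → Graph n → Fin n → Fin n → Graph n
delEdge G a b = mkGraph (vert G)
  (λ x y → edge G x y ∧ not ((x =ᶠ a ∧ y =ᶠ b) ∨ (x =ᶠ b ∧ y =ᶠ a)))

LegalLeft : ∀ {n} → Graph n → Fin n → Set
LegalLeft G v = (vert G v ≡ true) × (deg G v ≢ 1) × NoIsolated (delVertex G v)

LegalRight : ∀ {n} → Graph n → Fin n → Fin n → Set
LegalRight G a b = (edge G a b ≡ true) × NoIsolated (delEdge G a b)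

-- Right has a winning strategy (game is finite, so inductive = winning).
-- A player with no legal move loses.
mutual
  data RightWinsLeftToMove {n : ℕ} (G : Graph n) : Set where
    rwL : (∀ v → LegalLeft G v → RightWinsRightToMove (delVertex G v))
        → RightWinsLeftToMove G

  data RightWinsRightToMove {n : ℕ} (G : Graph n) : Set where
    rwR : (a b : Fin n) → LegalRight G a b
        → RightWinsLeftToMove (delEdge G a b)
        → RightWinsRightToMove G

cycleAdj : ∀ {n} → Fin n → Fin n → Bool
cycleAdj {n} i j =
  (suc (toℕ i) ≡ᵇ toℕ j) ∨ (suc (toℕ j) ≡ᵇ toℕ i)
  ∨ ((toℕ i ≡ᵇ 0) ∧ (suc (toℕ j) ≡ᵇ n))
  ∨ ((toℕ j ≡ᵇ 0) ∧ (suc (toℕ i) ≡ᵇ n))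

C : (n : ℕ) → Graph n
C n = mkGraph (λ _ → true) cycleAdj

{-# OPTIONS --safe #-}

-- After the first move, and after renumbering the cycle so that the path left by that move
-- starts at 0, every position is a row of paths P_L (L ≥ 2) and single deleted vertices.
-- Left may delete neither a leaf nor the neighbour of a leaf (that would isolate the leaf),
-- so her moves split some P_(a+1+b) into P_a, a gap and P_b with a, b ≥ 2; Right's moves cut
-- some P_(a+b) into P_a and P_b with a, b ≥ 2. Right wins with Left to move whenever some path
-- is a P_4 or all paths have at most 3 vertices: Left can never split a P_4, and Right answers
-- each of her moves by cutting a P_2 off another path with at least 4 vertices or, if there
-- is none, by cutting the P_4 into two P_2, after which Left is stuck.
-- If Left starts, C_n becomes P_(n-1) and Right cuts off a P_4. If Right starts, C_n becomes
-- P_n, Left splits it into P_a and P_b with a + b = n - 1 ≥ 7, and Right cuts a P_4 off a part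
-- with at least 6 vertices; otherwise one part is a P_4, or one is a P_5 and the other has at
-- most 3 vertices and Right cuts the P_5 into P_2 and P_3. Only a = b = 5, i.e. n = 11, escapes.

module Submission where

open import Defs
open import Function using (id; _∘_; _∘′_; _⇔_; mk⇔; Equivalence)
open import Data.Unit using (⊤)
open import Data.Empty using (⊥; ⊥-elim)
open import Data.Bool using (Bool; true; false; _∧_; _∨_; not; if_then_else_)
open import Data.Bool.Properties using (∧-comm; ∨-comm; ∧-zeroʳ; ∨-zeroʳ; ∧-identityʳ; ∨-identityʳ; ⇔→≡)
open import Data.Nat
open import Data.Nat.Properties
open import Data.Nat.ListAction using (sum)
open import Data.Nat.Induction using (<-wellFounded)
open import Data.Nat.Tactic.RingSolver using (solve-∀)
open import Data.Fin as Fin using (Fin; toℕ; fromℕ<)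
open import Data.Fin.Properties using (toℕ-injective; toℕ<n; toℕ-fromℕ<)
  renaming (_≟_ to _≟ᶠ_; suc-injective to Fin-suc-injective)
open import Data.Product using (∃-syntax; _×_; _,_; proj₁; proj₂)
open import Data.Sum using (_⊎_; inj₁; inj₂)
open import Data.List using (List; []; _∷_; _++_; length; replicate; concatMap; tabulate)
open import Data.List.Properties
  using (++-assoc; ++-identityʳ; length-++; length-replicate; concatMap-++; map-tabulate)
open import Data.List.Membership.Propositional using (_∈_)
open import Data.List.Relation.Unary.All as All using (All; []; _∷_)
open import Data.List.Relation.Unary.All.Properties using (++⁺; ++⁻ˡ; ++⁻ʳ)
open import Data.List.Relation.Unary.Any using (Any; here; there)
open import Induction.WellFounded using (Acc; acc)
open import Relation.Nullary using (¬_; yes; no)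
open import Relation.Binary.PropositionalEquality

-- The game on rows of paths

data Segment : Set where
  gap  : Segment
  path : ℕ → Segment

data LeftSplit : List Segment → List Segment → Set where
  here  : ∀ a c xs → LeftSplit (path (2 + a + (3 + c)) ∷ xs) (path (2 + a) ∷ gap ∷ path (2 + c) ∷ xs)
  there : ∀ {x xs ys} → LeftSplit xs ys → LeftSplit (x ∷ xs) (x ∷ ys)

data RightCut : List Segment → List Segment → Set where
  here  : ∀ a c xs → RightCut (path (2 + a + (2 + c)) ∷ xs) (path (2 + a) ∷ path (2 + c) ∷ xs)
  there : ∀ {x xs ys} → RightCut xs ys → RightCut (x ∷ xs) (x ∷ ys)

mutual
  data RightWinsᴸ (xs : List Segment) : Set where
    rightWinsᴸ : (∀ {ys} → LeftSplit xs ys → RightWinsᴿ ys) → RightWinsᴸ xs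

  data RightWinsᴿ (xs : List Segment) : Set where
    rightWinsᴿ : ∀ {ys} → RightCut xs ys → RightWinsᴸ ys → RightWinsᴿ xs

order : List Segment → ℕ
order []            = 0
order (gap ∷ xs)    = order xs
order (path L ∷ xs) = L + order xs

order-leftSplit : ∀ {xs ys} → LeftSplit xs ys → order ys < order xs
order-leftSplit (here a c xs) = ≤-reflexive (eq a c (order xs))
  where
  eq : ∀ a c r → suc (2 + a + (2 + c + r)) ≡ 2 + a + (3 + c) + r
  eq = solve-∀
order-leftSplit (there {gap} s)    = order-leftSplit s
order-leftSplit (there {path L} s) = +-monoʳ-< L (order-leftSplit s)

order-rightCut : ∀ {xs ys} → RightCut xs ys → order ys ≡ order xs
order-rightCut (here a c xs) = eq a c (order xs)
  where
  eq : ∀ a c r → 2 + a + (2 + c + r) ≡ 2 + a + (2 + c) + r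
  eq = solve-∀
order-rightCut (there {gap} s)    = order-rightCut s
order-rightCut (there {path L} s) = cong (L +_) (order-rightCut s)

data Short : Segment → Set where
  short-gap  : Short gap
  short-path : ∀ {L} → L ≤ 3 → Short (path L)

data Long : Segment → Set where
  long-path : ∀ c → Long (path (4 + c))

short₂ : Short (path 2)
short₂ = short-path (n≤1+n 2)

short₃ : Short (path 3)
short₃ = short-path ≤-refl

long-or-short : ∀ x → Long x ⊎ Short x
long-or-short gap      = inj₂ short-gap
long-or-short (path 0) = inj₂ (short-path z≤n)
long-or-short (path 1) = inj₂ (short-path (s≤s z≤n))
long-or-short (path 2) = inj₂ short₂
long-or-short (path 3) = inj₂ short₃
long-or-short (path (suc (suc (suc (suc c))))) = inj₁ (long-path c)

any-long-or-all-short : ∀ xs → Any Long xs ⊎ All Short xs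
any-long-or-all-short []       = inj₂ []
any-long-or-all-short (x ∷ xs) with long-or-short x | any-long-or-all-short xs
... | inj₁ l | _       = inj₁ (here l)
... | inj₂ _ | inj₁ ls = inj₁ (there ls)
... | inj₂ s | inj₂ ss = inj₂ (s ∷ ss)

Reserve : List Segment → Set
Reserve xs = path 4 ∈ xs ⊎ All Short xs

leftSplit-notShort : ∀ {xs ys} → LeftSplit xs ys → All Short xs → ⊥
leftSplit-notShort (here a c xs) (short-path le ∷ _) =
  <⇒≱ (s≤s (s≤s (≤-trans (s≤s (s≤s z≤n)) (m≤n+m (3 + c) a)))) le
leftSplit-notShort (there s)     (_ ∷ ss)            = leftSplit-notShort s ss

path₄≢split : ∀ a c → path 4 ≢ path (2 + a + (3 + c))
path₄≢split 0                   c ()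
path₄≢split 1                   c ()
path₄≢split 2                   c ()
path₄≢split (suc (suc (suc a))) c ()

leftSplit-keeps-path₄ : ∀ {xs ys} → LeftSplit xs ys → path 4 ∈ xs → path 4 ∈ ys
leftSplit-keeps-path₄ (here a c xs) (here eq) = ⊥-elim (path₄≢split a c eq)
leftSplit-keeps-path₄ (here a c xs) (there m) = there (there (there m))
leftSplit-keeps-path₄ (there s)     (here eq) = here eq
leftSplit-keeps-path₄ (there s)     (there m) = there (leftSplit-keeps-path₄ s m)

cutLong : ∀ {xs} → Any Long xs → ∃[ ys ] RightCut xs ys
cutLong (here (long-path c)) = _ , here 0 c _
cutLong (there l)       = let ys , cut = cutLong l in _ , there cut

rightReply : ∀ {xs} → path 4 ∈ xs → ∃[ ys ] RightCut xs ys × Reserve ys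
rightReply {path 4 ∷ xs} (here refl) with any-long-or-all-short xs
... | inj₁ l  = let ys , cut = cutLong l in _ , there cut , inj₁ (here refl)
... | inj₂ ss = _ , here 0 0 xs , inj₂ (short₂ ∷ short₂ ∷ ss)
rightReply {x ∷ xs} (there m) with long-or-short x
... | inj₁ (long-path c) = _ , here 0 c xs , inj₁ (there (there m))
... | inj₂ s with rightReply m
...   | ys , cut , inj₁ m′ = _ , there cut , inj₁ (there m′)
...   | ys , cut , inj₂ ss = _ , there cut , inj₂ (s ∷ ss)

reserve⇒rightWinsᴸ : ∀ {xs} → Reserve xs → RightWinsᴸ xs
reserve⇒rightWinsᴸ = go (<-wellFounded _)
  where
  go : ∀ {xs} → Acc _<_ (order xs) → Reserve xs → RightWinsᴸ xs
  go (acc rec) (inj₁ m)  = rightWinsᴸ λ split →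
    let zs , cut , r = rightReply (leftSplit-keeps-path₄ split m) in
    rightWinsᴿ cut (go (rec (subst (_< _) (sym (order-rightCut cut)) (order-leftSplit split))) r)
  go _         (inj₂ ss) = rightWinsᴸ λ split → ⊥-elim (leftSplit-notShort split ss)

rightWinsᴿ-long : ∀ c xs → RightWinsᴿ (path (6 + c) ∷ xs)
rightWinsᴿ-long c xs = rightWinsᴿ (here 2 c xs) (reserve⇒rightWinsᴸ (inj₁ (here refl)))

replyToFirstSplit : ∀ a c → 3 ≤ a + c → a + c ≢ 6 →
  ∃[ ys ] RightCut (path (2 + a) ∷ gap ∷ path (2 + c) ∷ []) ys × Reserve ys
replyToFirstSplit (suc (suc (suc (suc d)))) c _ _ = _ , here 2 d _ , inj₁ (here refl)
replyToFirstSplit a (suc (suc (suc (suc d)))) _ _ = _ , there (there (here 2 d [])) , inj₁ (there (there (here refl)))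
replyToFirstSplit 2 c _ _ = rightReply (here refl)
replyToFirstSplit a 2 _ _ = rightReply (there (there (here refl)))
replyToFirstSplit 3 3 _ ne = ⊥-elim (ne refl)
replyToFirstSplit 3 0 _ _ = _ , here 0 1 _ , inj₂ (short₂ ∷ short₃ ∷ short-gap ∷ short₂ ∷ [])
replyToFirstSplit 3 1 _ _ = _ , here 0 1 _ , inj₂ (short₂ ∷ short₃ ∷ short-gap ∷ short₃ ∷ [])
replyToFirstSplit 0 3 _ _ = _ , there (there (here 0 1 [])) , inj₂ (short₂ ∷ short-gap ∷ short₂ ∷ short₃ ∷ [])
replyToFirstSplit 1 3 _ _ = _ , there (there (here 0 1 [])) , inj₂ (short₃ ∷ short-gap ∷ short₂ ∷ short₃ ∷ [])
replyToFirstSplit 0 0 () _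
replyToFirstSplit 0 1 (s≤s ()) _
replyToFirstSplit 1 0 (s≤s ()) _
replyToFirstSplit 1 1 (s≤s (s≤s ())) _

rightWinsᴿ-firstSplit : ∀ {n ys} → 8 ≤ n → n ≢ 11 → LeftSplit (path n ∷ []) ys → RightWinsᴿ ys
rightWinsᴿ-firstSplit le ne (here a c []) =
  let zs , cut , r = replyToFirstSplit a c (+-cancelˡ-≤ 5 3 (a + c) (subst (8 ≤_) (size a c) le))
                                          (λ a+c≡6 → ne (trans (size a c) (cong (5 +_) a+c≡6)))
  in rightWinsᴿ cut (reserve⇒rightWinsᴸ r)
  where
  size : ∀ a c → 2 + a + (3 + c) ≡ 5 + (a + c)
  size = solve-∀

rightWinsᴸ-path : ∀ {n} → 8 ≤ n → n ≢ 11 → RightWinsᴸ (path n ∷ [])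
rightWinsᴸ-path le ne = rightWinsᴸ (rightWinsᴿ-firstSplit le ne)

leftSplit-at : ∀ pre a c post →
  LeftSplit (pre ++ path (2 + a + (3 + c)) ∷ post) (pre ++ path (2 + a) ∷ gap ∷ path (2 + c) ∷ post)
leftSplit-at []        a c post = here a c post
leftSplit-at (x ∷ pre) a c post = there (leftSplit-at pre a c post)

data RightCutAt : List Segment → List Segment → Set where
  cutAt : ∀ pre a c post →
    RightCutAt (pre ++ path (2 + a + (2 + c)) ∷ post) (pre ++ path (2 + a) ∷ path (2 + c) ∷ post)

rightCutAt : ∀ {xs ys} → RightCut xs ys → RightCutAt xs ys
rightCutAt (here a c xs) = cutAt [] a c xs
rightCutAt (there {x} cut) with rightCutAt cut
... | cutAt pre a c post = cutAt (x ∷ pre) a c post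

countTrue : ∀ {n} → (Fin n → Bool) → ℕ
countTrue f = sum (tabulate (λ j → if f j then 1 else 0))

countTrue-pos : ∀ {n} (f : Fin n → Bool) {a} → f a ≡ true → 0 < countTrue f
countTrue-pos f {Fin.zero}  fa≡true rewrite fa≡true = s≤s z≤n
countTrue-pos f {Fin.suc a} fa≡true =
  ≤-trans (countTrue-pos (f ∘ Fin.suc) fa≡true) (m≤n+m _ (if f Fin.zero then 1 else 0))

countTrue-zero : ∀ {n} (f : Fin n → Bool) → (∀ j → f j ≡ false) → countTrue f ≡ 0
countTrue-zero {zero}  f none = refl
countTrue-zero {suc n} f none rewrite none Fin.zero = countTrue-zero (f ∘ Fin.suc) (none ∘ Fin.suc)

countTrue-one : ∀ {n} (f : Fin n → Bool) {a} → f a ≡ true → (∀ j → f j ≡ true → j ≡ a) → countTrue f ≡ 1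
countTrue-one f {Fin.zero} fa≡true only rewrite fa≡true = cong suc (countTrue-zero (f ∘ Fin.suc) rest)
  where
  rest : ∀ j → f (Fin.suc j) ≡ false
  rest j with f (Fin.suc j) in fj
  ... | false = refl
  ... | true  with () ← only (Fin.suc j) fj
countTrue-one f {Fin.suc a} fa≡true only with f Fin.zero in f0
... | true  with () ← only Fin.zero f0
... | false = countTrue-one (f ∘ Fin.suc) fa≡true (λ j fj → Fin-suc-injective (only (Fin.suc j) fj))

module _ {n} (G : Graph n) (x : Fin n) where

  deg≡countTrue : deg G x ≡ countTrue (edge G x)
  deg≡countTrue = cong sum (map-tabulate id (λ j → if edge G x j then 1 else 0))

  deg-pos : ∀ {y} → edge G x y ≡ true → 0 < deg G x
  deg-pos xy = subst (0 <_) (sym deg≡countTrue) (countTrue-pos (edge G x) xy)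

  deg-zero : (∀ y → edge G x y ≡ false) → deg G x ≡ 0
  deg-zero none = trans deg≡countTrue (countTrue-zero (edge G x) none)

  deg-one : ∀ {y} → edge G x y ≡ true → (∀ z → edge G x z ≡ true → z ≡ y) → deg G x ≡ 1
  deg-one xy only = trans deg≡countTrue (countTrue-one (edge G x) xy only)

∧-true : ∀ {a b} → a ∧ b ≡ true → a ≡ true × b ≡ true
∧-true {true} {true} _ = refl , refl

∨-true : ∀ {a b} → a ∨ b ≡ true → a ≡ true ⊎ b ≡ true
∨-true {true}  _ = inj₁ refl
∨-true {false} e = inj₂ e

∨-introˡ : ∀ {a} b → a ≡ true → a ∨ b ≡ true
∨-introˡ _ refl = refl

∨-introʳ : ∀ a {b} → b ≡ true → a ∨ b ≡ true
∨-introʳ true  _    = refl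
∨-introʳ false refl = refl

∧-intro : ∀ {a b} → a ≡ true → b ≡ true → a ∧ b ≡ true
∧-intro refl refl = refl

not-true⇒≢true : ∀ {a} → not a ≡ true → a ≢ true
not-true⇒≢true {true} () _

≡ᵇ-refl : ∀ k → (k ≡ᵇ k) ≡ true
≡ᵇ-refl zero    = refl
≡ᵇ-refl (suc k) = ≡ᵇ-refl k

≡⇒≡ᵇ-true : ∀ {j k} → j ≡ k → (j ≡ᵇ k) ≡ true
≡⇒≡ᵇ-true {j} refl = ≡ᵇ-refl j

≢⇒≡ᵇ-false : ∀ {j k} → j ≢ k → (j ≡ᵇ k) ≡ false
≢⇒≡ᵇ-false {zero}  {zero}  j≢k = ⊥-elim (j≢k refl)
≢⇒≡ᵇ-false {zero}  {suc k} _   = refl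
≢⇒≡ᵇ-false {suc j} {zero}  _   = refl
≢⇒≡ᵇ-false {suc j} {suc k} j≢k = ≢⇒≡ᵇ-false (j≢k ∘′ cong suc)

≡ᵇ-true⇒≡ : ∀ {j k} → (j ≡ᵇ k) ≡ true → j ≡ k
≡ᵇ-true⇒≡ {zero}  {zero}  _ = refl
≡ᵇ-true⇒≡ {suc j} {suc k} e = cong suc (≡ᵇ-true⇒≡ e)

<⇒<ᵇ-true : ∀ {m n} → m < n → (m <ᵇ n) ≡ true
<⇒<ᵇ-true {zero}  {suc n} _         = refl
<⇒<ᵇ-true {suc m} {suc n} (s≤s m<n) = <⇒<ᵇ-true m<n

≥⇒<ᵇ-false : ∀ {m n} → n ≤ m → (m <ᵇ n) ≡ false
≥⇒<ᵇ-false {m}     {zero}  _         = refl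
≥⇒<ᵇ-false {suc m} {suc n} (s≤s n≤m) = ≥⇒<ᵇ-false n≤m

<ᵇ-true⇒< : ∀ {m n} → (m <ᵇ n) ≡ true → m < n
<ᵇ-true⇒< {zero}  {suc n} _ = s≤s z≤n
<ᵇ-true⇒< {suc m} {suc n} e = s≤s (<ᵇ-true⇒< e)

not-≡ᵇ≡<ᵇ : ∀ {k m} → k < suc m → not (k ≡ᵇ m) ≡ (k <ᵇ m)
not-≡ᵇ≡<ᵇ {zero}  {zero}  _         = refl
not-≡ᵇ≡<ᵇ {zero}  {suc m} _         = refl
not-≡ᵇ≡<ᵇ {suc k} {suc m} (s≤s k<) = not-≡ᵇ≡<ᵇ k<

≡ᵇ∧≡ᵇ-false : ∀ {i j k l} → ¬ (i ≡ k × j ≡ l) → (i ≡ᵇ k) ∧ (j ≡ᵇ l) ≡ false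
≡ᵇ∧≡ᵇ-false {i} {j} {k} {l} ne with i ≟ k
... | no  i≢k  rewrite ≢⇒≡ᵇ-false i≢k = refl
... | yes refl rewrite ≡ᵇ-refl i | ≢⇒≡ᵇ-false {j} {l} (λ j≡l → ne (refl , j≡l)) = refl

-- Rotations of the cycle

CyclicSucc : ℕ → ℕ → ℕ → Set
CyclicSucc n t u = suc t ≡ u ⊎ (suc t ≡ n × u ≡ 0)

cyclicSucc-functional : ∀ {n t u u′} → u < n → u′ < n → CyclicSucc n t u → CyclicSucc n t u′ → u ≡ u′
cyclicSucc-functional _   _    (inj₁ e)       (inj₁ e′)       = trans (sym e) e′
cyclicSucc-functional u<n _    (inj₁ e)       (inj₂ (e′ , _)) = ⊥-elim (<-irrefl (trans (sym e) e′) u<n)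
cyclicSucc-functional _   u′<n (inj₂ (e , _)) (inj₁ e′)       = ⊥-elim (<-irrefl (trans (sym e′) e) u′<n)
cyclicSucc-functional _   _    (inj₂ (_ , e)) (inj₂ (_ , e′)) = trans e (sym e′)

cyclicSucc-exists : ∀ {n t} → t < n → ∃[ u ] u < n × CyclicSucc n t u
cyclicSucc-exists {n} {t} t<n with suc t <? n
... | yes 1+t<n = suc t , 1+t<n , inj₁ refl
... | no  1+t≮n = 0 , ≤-<-trans z≤n t<n , inj₂ (≤-antisym t<n (≮⇒≥ 1+t≮n) , refl)

module Rotation (n b : ℕ) (b<n : b < n) where

  data RotateView (t : ℕ) : Set where
    above : b ≤ t → RotateView t
    below : t < b → RotateView t

  rotateView : ∀ t → RotateView t
  rotateView t with b ≤? t
  ... | yes b≤t = above b≤t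
  ... | no  b≰t = below (≰⇒> b≰t)

  rotate : ℕ → ℕ
  rotate t with rotateView t
  ... | above _ = t ∸ b
  ... | below _ = t + (n ∸ b)

  rotate-above : ∀ {t} → b ≤ t → rotate t ≡ t ∸ b
  rotate-above {t} b≤t with rotateView t
  ... | above _   = refl
  ... | below t<b = ⊥-elim (<⇒≱ t<b b≤t)

  rotate-below : ∀ {t} → t < b → rotate t ≡ t + (n ∸ b)
  rotate-below {t} t<b with rotateView t
  ... | above b≤t = ⊥-elim (<⇒≱ t<b b≤t)
  ... | below _   = refl

  b+[n∸b]≡n : b + (n ∸ b) ≡ n
  b+[n∸b]≡n = m+[n∸m]≡n (<⇒≤ b<n)

  rotate-< : ∀ {t} → t < n → rotate t < n
  rotate-< {t} t<n with rotateView t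
  ... | above _   = ≤-<-trans (m∸n≤m t b) t<n
  ... | below t<b = subst (t + (n ∸ b) <_) b+[n∸b]≡n (+-monoˡ-< (n ∸ b) t<b)

  private
    above≢below : ∀ {t u} → b ≤ t → t < n → t ∸ b ≢ u + (n ∸ b)
    above≢below b≤t t<n e = <⇒≱ (∸-monoˡ-< t<n b≤t) (subst (n ∸ b ≤_) (sym e) (m≤n+m (n ∸ b) _))

  rotate-injective : ∀ {t u} → t < n → u < n → rotate t ≡ rotate u → t ≡ u
  rotate-injective {t} {u} t<n u<n e with rotateView t | rotateView u
  ... | above b≤t | above b≤u = ∸-cancelʳ-≡ b≤t b≤u e
  ... | below _   | below _   = +-cancelʳ-≡ (n ∸ b) t u e
  ... | above b≤t | below _   = ⊥-elim (above≢below b≤t t<n e)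
  ... | below _   | above b≤u = ⊥-elim (above≢below b≤u u<n (sym e))

  rotate-surjective : ∀ {k} → k < n → ∃[ t ] t < n × rotate t ≡ k
  rotate-surjective {k} k<n with k <? n ∸ b
  ... | yes k<n∸b = k + b , subst (k + b <_) (trans (+-comm (n ∸ b) b) b+[n∸b]≡n) (+-monoˡ-< b k<n∸b)
                          , trans (rotate-above (m≤n+m b k)) (m+n∸n≡m k b)
  ... | no  k≮n∸b = k ∸ (n ∸ b) , <-trans k∸[n∸b]<b b<n
                          , trans (rotate-below k∸[n∸b]<b) (m∸n+n≡m (≮⇒≥ k≮n∸b))
    where
    k∸[n∸b]<b : k ∸ (n ∸ b) < b
    k∸[n∸b]<b = +-cancelʳ-< (n ∸ b) _ _
      (subst₂ _<_ (sym (m∸n+n≡m (≮⇒≥ k≮n∸b))) (sym b+[n∸b]≡n) k<n)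

  rotate-cyclicSucc : ∀ {t u} → t < n → CyclicSucc n t u → CyclicSucc n (rotate t) (rotate u)
  rotate-cyclicSucc {t} t<n (inj₁ refl) with rotateView t | rotateView (suc t)
  ... | above b≤t | above _     = inj₁ (sym (+-∸-assoc 1 b≤t))
  ... | above b≤t | below 1+t<b = ⊥-elim (<⇒≱ 1+t<b (m≤n⇒m≤1+n b≤t))
  ... | below t<b | above b≤1+t =
    inj₂ (trans (cong (_+ (n ∸ b)) (≤-antisym t<b b≤1+t)) b+[n∸b]≡n , m≤n⇒m∸n≡0 t<b)
  ... | below _   | below _     = inj₁ refl
  rotate-cyclicSucc {t} t<n (inj₂ (1+t≡n , refl)) with rotateView 0 | rotateView t
  ... | _         | below t<b = ⊥-elim (<⇒≱ t<b (s≤s⁻¹ (subst (b <_) (sym 1+t≡n) b<n)))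
  ... | above b≤0 | above b≤t = inj₂ (trans (cong (λ z → suc (t ∸ z)) (n≤0⇒n≡0 b≤0)) 1+t≡n , 0∸n≡0 b)
  ... | below _   | above b≤t = inj₁ (trans (sym (+-∸-assoc 1 b≤t)) (cong (_∸ b) 1+t≡n))

  rotate-cyclicSucc⁻ : ∀ {t u} → t < n → u < n → CyclicSucc n (rotate t) (rotate u) → CyclicSucc n t u
  rotate-cyclicSucc⁻ {t} t<n u<n s with cyclicSucc-exists t<n
  ... | u′ , u′<n , s′ = subst (CyclicSucc n t)
    (rotate-injective u′<n u<n (cyclicSucc-functional (rotate-< u′<n) (rotate-< u<n) (rotate-cyclicSucc t<n s′) s)) s′

cycleAdj⇒cyclicSucc : ∀ {n} (x y : Fin n) → cycleAdj x y ≡ true →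
                      CyclicSucc n (toℕ x) (toℕ y) ⊎ CyclicSucc n (toℕ y) (toℕ x)
cycleAdj⇒cyclicSucc x y adj with ∨-true adj
... | inj₁ e = inj₁ (inj₁ (≡ᵇ-true⇒≡ e))
... | inj₂ adj′ with ∨-true adj′
...   | inj₁ e = inj₂ (inj₁ (≡ᵇ-true⇒≡ e))
...   | inj₂ adj″ with ∨-true adj″
...     | inj₁ h = let x≡0 , y+1≡n = ∧-true h in inj₂ (inj₂ (≡ᵇ-true⇒≡ y+1≡n , ≡ᵇ-true⇒≡ x≡0))
...     | inj₂ h = let y≡0 , x+1≡n = ∧-true h in inj₁ (inj₂ (≡ᵇ-true⇒≡ x+1≡n , ≡ᵇ-true⇒≡ y≡0))

cyclicSucc⇒cycleAdj : ∀ {n} (x y : Fin n) → CyclicSucc n (toℕ x) (toℕ y) ⊎ CyclicSucc n (toℕ y) (toℕ x) →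
                      cycleAdj x y ≡ true
cyclicSucc⇒cycleAdj {n} x y = adj (toℕ x) (toℕ y)
  where
  adj : ∀ i j → CyclicSucc n i j ⊎ CyclicSucc n j i →
        ((suc i ≡ᵇ j) ∨ (suc j ≡ᵇ i) ∨ ((i ≡ᵇ 0) ∧ (suc j ≡ᵇ n)) ∨ ((j ≡ᵇ 0) ∧ (suc i ≡ᵇ n))) ≡ true
  adj i j (inj₁ (inj₁ e)) = ∨-introˡ _ (≡⇒≡ᵇ-true e)
  adj i j (inj₂ (inj₁ e)) = ∨-introʳ (suc i ≡ᵇ j) (∨-introˡ _ (≡⇒≡ᵇ-true e))
  adj i j (inj₂ (inj₂ (j+1≡n , i≡0))) = ∨-introʳ (suc i ≡ᵇ j) (∨-introʳ (suc j ≡ᵇ i)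
    (∨-introˡ _ (∧-intro (≡⇒≡ᵇ-true i≡0) (≡⇒≡ᵇ-true j+1≡n))))
  adj i j (inj₁ (inj₂ (i+1≡n , j≡0))) = ∨-introʳ (suc i ≡ᵇ j) (∨-introʳ (suc j ≡ᵇ i)
    (∨-introʳ ((i ≡ᵇ 0) ∧ (suc j ≡ᵇ n)) (∧-intro (≡⇒≡ᵇ-true j≡0) (≡⇒≡ᵇ-true i+1≡n))))

CyclicAdjacent : ℕ → ℕ → ℕ → Set
CyclicAdjacent n i j = CyclicSucc n i j ⊎ CyclicSucc n j i

PathAdjacent : ℕ → ℕ → ℕ → Set
PathAdjacent m i j = (suc i ≡ j × j < m) ⊎ (suc j ≡ i × i < m)

pathAdjacent⇒cyclicAdjacent : ∀ {m n i j} → PathAdjacent m i j → CyclicAdjacent n i j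
pathAdjacent⇒cyclicAdjacent (inj₁ (e , _)) = inj₁ (inj₁ e)
pathAdjacent⇒cyclicAdjacent (inj₂ (e , _)) = inj₂ (inj₁ e)

pathAdjacent-< : ∀ {m i j} → PathAdjacent m i j → i < m × j < m
pathAdjacent-< (inj₁ (refl , j<m)) = <-trans (n<1+n _) j<m , j<m
pathAdjacent-< (inj₂ (refl , i<m)) = i<m , <-trans (n<1+n _) i<m

pathAdjacent-sym : ∀ {m i j} → PathAdjacent m i j → PathAdjacent m j i
pathAdjacent-sym (inj₁ p) = inj₂ p
pathAdjacent-sym (inj₂ p) = inj₁ p

cyclicAdjacent-cases : ∀ {m i j} → i < suc m → j < suc m → CyclicAdjacent (suc m) i j →
                       PathAdjacent (suc m) i j ⊎ (i ≡ m × j ≡ 0) ⊎ (j ≡ m × i ≡ 0)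
cyclicAdjacent-cases _   j<n (inj₁ (inj₁ e))           = inj₁ (inj₁ (e , j<n))
cyclicAdjacent-cases i<n _   (inj₂ (inj₁ e))           = inj₁ (inj₂ (e , i<n))
cyclicAdjacent-cases _   _   (inj₁ (inj₂ (e , j≡0)))   = inj₂ (inj₁ (suc-injective e , j≡0))
cyclicAdjacent-cases _   _   (inj₂ (inj₂ (e , i≡0)))   = inj₂ (inj₂ (suc-injective e , i≡0))

pathAdjacent-notWrap : ∀ {m i j} → 2 ≤ m → PathAdjacent (suc m) i j → ¬ (i ≡ m × j ≡ 0)
pathAdjacent-notWrap _           (inj₁ (refl , j<1+m)) (refl , _)    = <-irrefl refl j<1+m
pathAdjacent-notWrap (s≤s (s≤s _)) (inj₂ (refl , _))    (refl , ())

-- Rows of paths as rows of cells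

-- A cell is one position of the row: is its vertex present, and is the edge to the next
-- position present.
Cell : Set
Cell = Bool × Bool

linkedCell endCell emptyCell : Cell
linkedCell = true  , true
endCell    = true  , false
emptyCell  = false , false

pathCells : ℕ → List Cell
pathCells zero          = []
pathCells (suc zero)    = endCell ∷ []
pathCells (suc (suc L)) = linkedCell ∷ pathCells (suc L)

segmentCells : Segment → List Cell
segmentCells gap      = emptyCell ∷ []
segmentCells (path L) = pathCells L

cells : List Segment → List Cell
cells = concatMap segmentCells

cellAt : List Cell → ℕ → Cell
cellAt []       _       = emptyCell
cellAt (c ∷ cs) zero    = c
cellAt (c ∷ cs) (suc i) = cellAt cs i

present linked : List Cell → ℕ → Bool
present cs i = proj₁ (cellAt cs i)
linked  cs i = proj₂ (cellAt cs i)

adjacent : List Cell → ℕ → ℕ → Bool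
adjacent cs i j = ((suc i ≡ᵇ j) ∧ linked cs i) ∨ ((suc j ≡ᵇ i) ∧ linked cs j)

cellAt-++ʳ : ∀ X Y i → cellAt (X ++ Y) (length X + i) ≡ cellAt Y i
cellAt-++ʳ []      Y i = refl
cellAt-++ʳ (_ ∷ X) Y i = cellAt-++ʳ X Y i

cellAt-++ˡ : ∀ X Y {i} → i < length X → cellAt (X ++ Y) i ≡ cellAt X i
cellAt-++ˡ (_ ∷ X) Y {zero}  _         = refl
cellAt-++ˡ (_ ∷ X) Y {suc i} (s≤s i<X) = cellAt-++ˡ X Y i<X

cellAt-++-[] : ∀ X i → cellAt (X ++ []) i ≡ cellAt X i
cellAt-++-[] X i = cong (λ Z → cellAt Z i) (++-identityʳ X)

cellAt-middle : ∀ X (c : Cell) Y → cellAt (X ++ c ∷ Y) (length X) ≡ c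
cellAt-middle []      c Y = refl
cellAt-middle (_ ∷ X) c Y = cellAt-middle X c Y

cellAt-middle₂ : ∀ X (c d : Cell) Y → cellAt (X ++ c ∷ d ∷ Y) (suc (length X)) ≡ d
cellAt-middle₂ []      c d Y = refl
cellAt-middle₂ (_ ∷ X) c d Y = cellAt-middle₂ X c d Y

cellAt-replace : ∀ X (c c′ : Cell) Y {i} → i ≢ length X → cellAt (X ++ c ∷ Y) i ≡ cellAt (X ++ c′ ∷ Y) i
cellAt-replace []      c c′ Y {zero}  i≢0 = ⊥-elim (i≢0 refl)
cellAt-replace []      c c′ Y {suc i} _   = refl
cellAt-replace (_ ∷ X) c c′ Y {zero}  _   = refl
cellAt-replace (_ ∷ X) c c′ Y {suc i} i≢ = cellAt-replace X c c′ Y (λ e → i≢ (cong suc e))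

cellAt-replace₂ : ∀ X (c d c′ d′ : Cell) Y {i} → i ≢ length X → i ≢ suc (length X) →
                  cellAt (X ++ c ∷ d ∷ Y) i ≡ cellAt (X ++ c′ ∷ d′ ∷ Y) i
cellAt-replace₂ []      c d c′ d′ Y {0}           i≢0 _   = ⊥-elim (i≢0 refl)
cellAt-replace₂ []      c d c′ d′ Y {1}           _   i≢1 = ⊥-elim (i≢1 refl)
cellAt-replace₂ []      c d c′ d′ Y {suc (suc i)} _   _   = refl
cellAt-replace₂ (_ ∷ X) c d c′ d′ Y {zero}        _   _   = refl
cellAt-replace₂ (_ ∷ X) c d c′ d′ Y {suc i}       i≢ i≢′ =
  cellAt-replace₂ X c d c′ d′ Y (λ e → i≢ (cong suc e)) (λ e → i≢′ (cong suc e))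

length-pathCells : ∀ L → length (pathCells L) ≡ L
length-pathCells zero          = refl
length-pathCells (suc zero)    = refl
length-pathCells (suc (suc L)) = cong suc (length-pathCells (suc L))

cellAt-pathCells : ∀ L k → cellAt (pathCells L) k ≡ ((k <ᵇ L) , (suc k <ᵇ L))
cellAt-pathCells zero          k       = refl
cellAt-pathCells (suc zero)    zero    = refl
cellAt-pathCells (suc zero)    (suc k) = refl
cellAt-pathCells (suc (suc L)) zero    = refl
cellAt-pathCells (suc (suc L)) (suc k) = cellAt-pathCells (suc L) k

cellAt-pathCells-gap : ∀ L k → cellAt (pathCells L ++ emptyCell ∷ []) k ≡ ((k <ᵇ L) , (suc k <ᵇ L))
cellAt-pathCells-gap zero          zero          = refl
cellAt-pathCells-gap zero          (suc k)       = refl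
cellAt-pathCells-gap (suc zero)    zero          = refl
cellAt-pathCells-gap (suc zero)    (suc zero)    = refl
cellAt-pathCells-gap (suc zero)    (suc (suc k)) = refl
cellAt-pathCells-gap (suc (suc L)) zero          = refl
cellAt-pathCells-gap (suc (suc L)) (suc k)       = cellAt-pathCells-gap (suc L) k

linkedCells : ℕ → List Cell
linkedCells k = replicate k linkedCell

pathCells-+ : ∀ k m → pathCells (k + suc m) ≡ linkedCells k ++ pathCells (suc m)
pathCells-+ zero    m = refl
pathCells-+ (suc k) m rewrite +-suc k m = cong (linkedCell ∷_) (trans (cong pathCells (sym (+-suc k m))) (pathCells-+ k m))

pathCells-suc : ∀ k → pathCells (suc k) ≡ linkedCells k ++ endCell ∷ []
pathCells-suc zero    = refl
pathCells-suc (suc k) = cong (linkedCell ∷_) (pathCells-suc k)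

data EndsUnlinked : List Cell → Set where
  []  : EndsUnlinked []
  _∷ʳ_ : ∀ X b → EndsUnlinked (X ++ (b , false) ∷ [])

endsUnlinked-++ : ∀ {X Y} → EndsUnlinked X → EndsUnlinked Y → EndsUnlinked (X ++ Y)
endsUnlinked-++ {X} eX []         = subst EndsUnlinked (sym (++-identityʳ X)) eX
endsUnlinked-++ {X} _  (Z ∷ʳ b)   = subst EndsUnlinked (++-assoc X Z _) ((X ++ Z) ∷ʳ b)

endsUnlinked-pathCells : ∀ L → EndsUnlinked (pathCells L)
endsUnlinked-pathCells zero    = []
endsUnlinked-pathCells (suc L) = subst EndsUnlinked (sym (pathCells-suc L)) (linkedCells L ∷ʳ true)

endsUnlinked-cells : ∀ xs → EndsUnlinked (cells xs)
endsUnlinked-cells []            = []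
endsUnlinked-cells (gap ∷ xs)    = endsUnlinked-++ ([] ∷ʳ false) (endsUnlinked-cells xs)
endsUnlinked-cells (path L ∷ xs) = endsUnlinked-++ (endsUnlinked-pathCells L) (endsUnlinked-cells xs)

linked-last : ∀ {X} Y {p} → EndsUnlinked X → suc p ≡ length X → linked (X ++ Y) p ≡ false
linked-last Y {p} (Z ∷ʳ b) 1+p≡ = cong proj₂ (begin
    cellAt ((Z ++ (b , false) ∷ []) ++ Y) p ≡⟨ cong (λ W → cellAt W p) (++-assoc Z _ Y) ⟩
    cellAt (Z ++ (b , false) ∷ Y) p         ≡⟨ cong (cellAt (Z ++ (b , false) ∷ Y)) p≡Z ⟩
    cellAt (Z ++ (b , false) ∷ Y) (length Z) ≡⟨ cellAt-middle Z (b , false) Y ⟩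
    (b , false)                             ∎)
  where
  open ≡-Reasoning
  p≡Z : p ≡ length Z
  p≡Z = suc-injective (trans 1+p≡ (trans (length-++ Z) (+-comm (length Z) 1)))

data Location (xs : List Segment) (i : ℕ) : Set where
  at : ∀ pre L post o → xs ≡ pre ++ path L ∷ post → i ≡ length (cells pre) + o → o < L → Location xs i

locate : ∀ xs {i} → present (cells xs) i ≡ true → Location xs i
locate (gap ∷ xs) {suc i} pr with locate xs pr
... | at pre L post o refl refl o<L = at (gap ∷ pre) L post o refl refl o<L
locate (path L ∷ xs) {i} pr with i <? L
... | yes i<L = at [] L xs i refl refl i<L
... | no  i≮L with locate xs {i ∸ L} pr′
  where
  i≡ : i ≡ length (pathCells L) + (i ∸ L)
  i≡ = trans (sym (m+[n∸m]≡n (≮⇒≥ i≮L))) (cong (_+ (i ∸ L)) (sym (length-pathCells L)))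
  pr′ : present (cells xs) (i ∸ L) ≡ true
  pr′ = trans (cong proj₁ (sym (cellAt-++ʳ (pathCells L) (cells xs) (i ∸ L))))
              (subst (λ k → present (pathCells L ++ cells xs) k ≡ true) i≡ pr)
...   | at pre L′ post o refl i∸L≡ o<L′ = at (path L ∷ pre) L′ post o refl i≡ o<L′
  where
  i≡ : i ≡ length (pathCells L ++ cells pre) + o
  i≡ rewrite length-++ (pathCells L) {cells pre} | length-pathCells L | +-assoc L (length (cells pre)) o
    = trans (sym (m+[n∸m]≡n (≮⇒≥ i≮L))) (cong (L +_) i∸L≡)

module InPath (pre : List Segment) (L : ℕ) (post : List Segment) where

  s : ℕ
  s = length (cells pre)

  cells≡ : cells (pre ++ path L ∷ post) ≡ cells pre ++ (pathCells L ++ cells post)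
  cells≡ = concatMap-++ segmentCells pre (path L ∷ post)

  cellAt-inPath : ∀ {o} → o < L → cellAt (cells (pre ++ path L ∷ post)) (s + o) ≡ (true , (suc o <ᵇ L))
  cellAt-inPath {o} o<L = begin
    cellAt (cells (pre ++ path L ∷ post)) (s + o)      ≡⟨ cong (λ W → cellAt W (s + o)) cells≡ ⟩
    cellAt (cells pre ++ (pathCells L ++ cells post)) (s + o) ≡⟨ cellAt-++ʳ (cells pre) _ o ⟩
    cellAt (pathCells L ++ cells post) o
      ≡⟨ cellAt-++ˡ (pathCells L) (cells post) (subst (o <_) (sym (length-pathCells L)) o<L) ⟩
    cellAt (pathCells L) o                              ≡⟨ cellAt-pathCells L o ⟩
    ((o <ᵇ L) , (suc o <ᵇ L))                           ≡⟨ cong (_, (suc o <ᵇ L)) (<⇒<ᵇ-true o<L) ⟩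
    (true , (suc o <ᵇ L))                               ∎
    where open ≡-Reasoning

  present-inPath : ∀ {o} → o < L → present (cells (pre ++ path L ∷ post)) (s + o) ≡ true
  present-inPath o<L = cong proj₁ (cellAt-inPath o<L)

  linked-inPath : ∀ {o} → suc o < L → linked (cells (pre ++ path L ∷ post)) (s + o) ≡ true
  linked-inPath {o} 1+o<L = trans (cong proj₂ (cellAt-inPath (<-trans (n<1+n o) 1+o<L))) (<⇒<ᵇ-true 1+o<L)

  linked-pathEnd : ∀ {o} → suc o ≡ L → linked (cells (pre ++ path L ∷ post)) (s + o) ≡ false
  linked-pathEnd {o} refl = trans (cong proj₂ (cellAt-inPath (n<1+n o))) (≥⇒<ᵇ-false {suc o} ≤-refl)

  linked-beforePath : ∀ {p} → suc p ≡ s → linked (cells (pre ++ path L ∷ post)) p ≡ false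
  linked-beforePath {p} 1+p≡s =
    trans (cong (λ W → linked W p) cells≡) (linked-last _ (endsUnlinked-cells pre) 1+p≡s)

  pathEnd≤length : s + L ≤ length (cells (pre ++ path L ∷ post))
  pathEnd≤length rewrite cells≡ | length-++ (cells pre) {pathCells L ++ cells post}
                       | length-++ (pathCells L) {cells post} | length-pathCells L
    = +-monoʳ-≤ s (m≤m+n L _)

adjacent-cases : ∀ cs i j → adjacent cs i j ≡ true →
                 (suc i ≡ j × linked cs i ≡ true) ⊎ (suc j ≡ i × linked cs j ≡ true)
adjacent-cases cs i j adj with ∨-true adj
... | inj₁ h = let e , l = ∧-true h in inj₁ (≡ᵇ-true⇒≡ e , l)
... | inj₂ h = let e , l = ∧-true h in inj₂ (≡ᵇ-true⇒≡ e , l)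

adjacent-next : ∀ cs i → linked cs i ≡ true → adjacent cs i (suc i) ≡ true
adjacent-next cs i l rewrite ≡ᵇ-refl i | l = refl

adjacent-prev : ∀ cs j → linked cs j ≡ true → adjacent cs (suc j) j ≡ true
adjacent-prev cs j l rewrite ≡ᵇ-refl j | l = ∨-zeroʳ _

adjacent-restrict : ∀ cs cs′ (g : ℕ → ℕ → Bool) → (∀ a b → g a b ≡ g b a) →
                    (∀ k → linked cs′ k ≡ linked cs k ∧ g k (suc k)) →
                    ∀ i j → adjacent cs′ i j ≡ adjacent cs i j ∧ g i j
adjacent-restrict cs cs′ g g-sym lk i j with suc i ≟ j | suc j ≟ i
... | yes refl | yes 2+i≡i = ⊥-elim (m+1+n≢n 1 2+i≡i)
... | yes refl | no  2+i≢i rewrite ≡ᵇ-refl i | ≢⇒≡ᵇ-false 2+i≢i | lk i =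
  trans (∨-identityʳ _) (cong (_∧ g i (suc i)) (sym (∨-identityʳ (linked cs i))))
... | no 2+j≢j | yes refl rewrite ≡ᵇ-refl j | ≢⇒≡ᵇ-false 2+j≢j | lk j | g-sym j (suc j) = refl
... | no 1+i≢j | no 1+j≢i rewrite ≢⇒≡ᵇ-false 1+i≢j | ≢⇒≡ᵇ-false 1+j≢i = refl

module DeleteVertexCells (X Y : List Cell) where

  before after : List Cell
  before = X ++ linkedCell ∷ linkedCell ∷ Y
  after  = X ++ endCell ∷ emptyCell ∷ Y

  deleted : ℕ
  deleted = suc (length X)

  length-after : length after ≡ length before
  length-after = trans (length-++ X) (sym (length-++ X))

  present-after : ∀ k → present after k ≡ present before k ∧ not (k ≡ᵇ deleted)
  present-after k with k ≟ length X | k ≟ deleted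
  ... | yes refl | _ rewrite cellAt-middle X endCell (emptyCell ∷ Y) | cellAt-middle X linkedCell (linkedCell ∷ Y)
                           | ≢⇒≡ᵇ-false {length X} {deleted} (1+n≢n ∘′ sym) = refl
  ... | no _ | yes refl rewrite cellAt-middle₂ X endCell emptyCell Y | cellAt-middle₂ X linkedCell linkedCell Y
                              | ≡ᵇ-refl deleted = refl
  ... | no k≢X | no k≢d rewrite cellAt-replace₂ X endCell emptyCell linkedCell linkedCell Y k≢X k≢d
                              | ≢⇒≡ᵇ-false k≢d = sym (∧-identityʳ _)

  linked-after : ∀ k → linked after k ≡ linked before k ∧ (not (k ≡ᵇ deleted) ∧ not (suc k ≡ᵇ deleted))
  linked-after k with k ≟ length X | k ≟ deleted
  ... | yes refl | _ rewrite cellAt-middle X endCell (emptyCell ∷ Y) | cellAt-middle X linkedCell (linkedCell ∷ Y)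
                           | ≢⇒≡ᵇ-false {length X} {deleted} (1+n≢n ∘′ sym) | ≡ᵇ-refl (length X) = refl
  ... | no _ | yes refl rewrite cellAt-middle₂ X endCell emptyCell Y | cellAt-middle₂ X linkedCell linkedCell Y
                              | ≡ᵇ-refl deleted = refl
  ... | no k≢X | no k≢d rewrite cellAt-replace₂ X endCell emptyCell linkedCell linkedCell Y k≢X k≢d
                              | ≢⇒≡ᵇ-false k≢d | ≢⇒≡ᵇ-false (k≢X ∘′ suc-injective) = sym (∧-identityʳ _)

module DeleteEdgeCells (X Y : List Cell) where

  before after : List Cell
  before = X ++ linkedCell ∷ Y
  after  = X ++ endCell ∷ Y

  length-after : length after ≡ length before
  length-after = trans (length-++ X) (sym (length-++ X))

  present-after : ∀ k → present after k ≡ present before k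
  present-after k with k ≟ length X
  ... | yes refl rewrite cellAt-middle X endCell Y | cellAt-middle X linkedCell Y = refl
  ... | no k≢X   rewrite cellAt-replace X endCell linkedCell Y k≢X = refl

  linked-after : ∀ k → linked after k ≡ linked before k ∧ not (k ≡ᵇ length X)
  linked-after k with k ≟ length X
  ... | yes refl rewrite cellAt-middle X endCell Y | cellAt-middle X linkedCell Y | ≡ᵇ-refl (length X) = refl
  ... | no k≢X   rewrite cellAt-replace X endCell linkedCell Y k≢X | ≢⇒≡ᵇ-false k≢X = sym (∧-identityʳ _)

cells-splitPath : ∀ pre k m post →
  cells (pre ++ path (k + suc m) ∷ post) ≡ (cells pre ++ linkedCells k) ++ pathCells (suc m) ++ cells post
cells-splitPath pre k m post = begin
  cells (pre ++ path (k + suc m) ∷ post)                         ≡⟨ concatMap-++ segmentCells pre _ ⟩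
  cells pre ++ pathCells (k + suc m) ++ cells post               ≡⟨ cong (λ W → cells pre ++ W ++ cells post) (pathCells-+ k m) ⟩
  cells pre ++ (linkedCells k ++ pathCells (suc m)) ++ cells post ≡⟨ cong (cells pre ++_) (++-assoc (linkedCells k) _ _) ⟩
  cells pre ++ linkedCells k ++ pathCells (suc m) ++ cells post   ≡⟨ ++-assoc (cells pre) _ _ ⟨
  (cells pre ++ linkedCells k) ++ pathCells (suc m) ++ cells post ∎
  where open ≡-Reasoning

cells-endPath : ∀ pre k post →
  cells (pre ++ path (suc k) ∷ post) ≡ (cells pre ++ linkedCells k) ++ endCell ∷ cells post
cells-endPath pre k post = begin
  cells (pre ++ path (suc k) ∷ post)                          ≡⟨ concatMap-++ segmentCells pre _ ⟩
  cells pre ++ pathCells (suc k) ++ cells post                ≡⟨ cong (λ W → cells pre ++ W ++ cells post) (pathCells-suc k) ⟩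
  cells pre ++ (linkedCells k ++ endCell ∷ []) ++ cells post  ≡⟨ cong (cells pre ++_) (++-assoc (linkedCells k) _ _) ⟩
  cells pre ++ linkedCells k ++ endCell ∷ cells post          ≡⟨ ++-assoc (cells pre) _ _ ⟨
  (cells pre ++ linkedCells k) ++ endCell ∷ cells post        ∎
  where open ≡-Reasoning

length-prefix : ∀ pre k → length (cells pre ++ linkedCells k) ≡ length (cells pre) + k
length-prefix pre k = trans (length-++ (cells pre)) (cong (length (cells pre) +_) (length-replicate k))

adjacent⇔pathAdjacent : ∀ cs m → (∀ k → linked cs k ≡ (suc k <ᵇ m)) →
                        ∀ i j → adjacent cs i j ≡ true ⇔ PathAdjacent m i j
adjacent⇔pathAdjacent cs m linked≡ i j = mk⇔ to from
  where
  to : adjacent cs i j ≡ true → PathAdjacent m i j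
  to adj with adjacent-cases cs i j adj
  ... | inj₁ (refl , l) = inj₁ (refl , <ᵇ-true⇒< (trans (sym (linked≡ i)) l))
  ... | inj₂ (refl , l) = inj₂ (refl , <ᵇ-true⇒< (trans (sym (linked≡ j)) l))
  from : PathAdjacent m i j → adjacent cs i j ≡ true
  from (inj₁ (refl , j<m)) = adjacent-next cs i (trans (linked≡ i) (<⇒<ᵇ-true j<m))
  from (inj₂ (refl , i<m)) = adjacent-prev cs j (trans (linked≡ j) (<⇒<ᵇ-true i<m))

-- Representing graph positions by rows of paths

Admissible : Segment → Set
Admissible gap      = ⊤
Admissible (path L) = 2 ≤ L

data OffsetView : ℕ → ℕ → Set where
  leftEnd        : ∀ {L} → OffsetView 0 L
  nextToLeftEnd  : ∀ {L} → OffsetView 1 L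
  rightEnd       : ∀ a → OffsetView (2 + a) (3 + a)
  nextToRightEnd : ∀ a → OffsetView (2 + a) (4 + a)
  interior       : ∀ a c → OffsetView (2 + a) (2 + a + (3 + c))

offsetView : ∀ {o L} → o < L → OffsetView o L
offsetView {0}           _   = leftEnd
offsetView {1}           _   = nextToLeftEnd
offsetView {suc (suc a)} {L} o<L = subst (OffsetView (2 + a)) (m∸n+n≡m o<L) (byRest (L ∸ (3 + a)))
  where
  byRest : ∀ r → OffsetView (2 + a) (r + (3 + a))
  byRest 0             = rightEnd a
  byRest 1             = nextToRightEnd a
  byRest (suc (suc c)) = subst (OffsetView (2 + a)) (comm a c) (interior a c)
    where
    comm : ∀ a c → 2 + a + (3 + c) ≡ 2 + c + (3 + a)
    comm = solve-∀

module Representation (n b : ℕ) (b<n : b < n) where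
  open Rotation n b b<n

  position : Fin n → ℕ
  position x = rotate (toℕ x)

  position-< : ∀ x → position x < n
  position-< x = rotate-< (toℕ<n x)

  position-injective : ∀ {x y} → position x ≡ position y → x ≡ y
  position-injective {x} {y} e = toℕ-injective (rotate-injective (toℕ<n x) (toℕ<n y) e)

  vertexAt : ∀ {k} → k < n → ∃[ x ] position x ≡ k
  vertexAt k<n with rotate-surjective k<n
  ... | t , t<n , e = fromℕ< t<n , trans (cong rotate (toℕ-fromℕ< t<n)) e

  =ᶠ-position : ∀ x y → (x =ᶠ y) ≡ (position x ≡ᵇ position y)
  =ᶠ-position x y with x ≟ᶠ y
  ... | yes refl = trans (≡ᵇ-refl (toℕ x)) (sym (≡ᵇ-refl (position x)))
  ... | no  x≢y  =
    trans (≢⇒≡ᵇ-false (x≢y ∘ toℕ-injective)) (sym (≢⇒≡ᵇ-false (x≢y ∘ position-injective)))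

  record Represents (G : Graph n) (xs : List Segment) : Set where
    constructor represents
    field
      vert≡ : ∀ x → vert G x ≡ present (cells xs) (position x)
      edge≡ : ∀ x y → edge G x y ≡ adjacent (cells xs) (position x) (position y)

  record WellFormed (xs : List Segment) : Set where
    constructor wellFormed
    field
      length≡    : length (cells xs) ≡ n
      admissible : All Admissible xs

  open Represents
  open WellFormed

  module _ {G : Graph n} {xs : List Segment} (rep : Represents G xs) where

    private
      adjacent⇒edge : ∀ {x y} → adjacent (cells xs) (position x) (position y) ≡ true → edge G x y ≡ true
      adjacent⇒edge {x} {y} = trans (edge≡ rep x y)

    represented-deg>0 : ∀ {x y} → adjacent (cells xs) (position x) (position y) ≡ true → 0 < deg G x
    represented-deg>0 {x} adj = deg-pos G x (adjacent⇒edge adj)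

    represented-deg≡1 : ∀ {x y} → adjacent (cells xs) (position x) (position y) ≡ true →
                        (∀ j → adjacent (cells xs) (position x) j ≡ true → j ≡ position y) → deg G x ≡ 1
    represented-deg≡1 {x} adj only =
      deg-one G x (adjacent⇒edge adj) (λ z xz → position-injective (only (position z) (trans (sym (edge≡ rep x z)) xz)))

    isolatedAfterDeleting : ∀ {u v} → (∀ j → adjacent (cells xs) (position u) j ≡ true → j ≡ position v) →
                            deg (delVertex G v) u ≡ 0
    isolatedAfterDeleting {u} {v} only = deg-zero (delVertex G v) u noEdge
      where
      noEdge : ∀ y → edge (delVertex G v) u y ≡ false
      noEdge y with edge G u y in uy
      ... | false = refl
      ... | true rewrite position-injective {y} {v} (only (position y) (trans (sym (edge≡ rep u y)) uy))
                       | ≡ᵇ-refl (toℕ v) = ∧-zeroʳ _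

  module AtPath {G : Graph n} {pre L post} (wf : WellFormed (pre ++ path L ∷ post))
                (rep : Represents G (pre ++ path L ∷ post)) where

    open InPath pre L post public

    private
      cs : List Cell
      cs = cells (pre ++ path L ∷ post)

    2≤L : 2 ≤ L
    2≤L = All.head (++⁻ʳ pre (admissible wf))

    vertexIn : ∀ {o} → o < L → ∃[ x ] position x ≡ s + o
    vertexIn o<L = vertexAt (subst (s + _ <_) (length≡ wf) (≤-trans (+-monoʳ-< s o<L) pathEnd≤length))

    adjacent-inPath : ∀ {o} → suc o < L → adjacent cs (s + o) (s + suc o) ≡ true
    adjacent-inPath {o} 1+o<L =
      subst (λ k → adjacent cs (s + o) k ≡ true) (sym (+-suc s o)) (adjacent-next cs (s + o) (linked-inPath 1+o<L))

    adjacent-inPath⁻ : ∀ {o} → suc o < L → adjacent cs (s + suc o) (s + o) ≡ true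
    adjacent-inPath⁻ {o} 1+o<L =
      subst (λ k → adjacent cs k (s + o) ≡ true) (sym (+-suc s o)) (adjacent-prev cs (s + o) (linked-inPath 1+o<L))

    neighbour-inPath : ∀ {o j} → o < L → adjacent cs (s + o) j ≡ true →
                       (suc o < L × j ≡ s + suc o) ⊎ ∃[ o′ ] o ≡ suc o′ × j ≡ s + o′
    neighbour-inPath {o} {j} o<L adj with adjacent-cases cs (s + o) j adj
    ... | inj₁ (1+s+o≡j , l) with suc o <? L
    ...   | yes 1+o<L = inj₁ (1+o<L , trans (sym 1+s+o≡j) (sym (+-suc s o)))
    ...   | no  1+o≮L with () ← trans (sym (linked-pathEnd (≤-antisym o<L (≮⇒≥ 1+o≮L)))) l
    neighbour-inPath {zero} {j} o<L adj | inj₂ (1+j≡s+0 , l)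
      with () ← trans (sym (linked-beforePath (trans 1+j≡s+0 (+-identityʳ s)))) l
    neighbour-inPath {suc o} {j} o<L adj | inj₂ (1+j≡s+1+o , l) =
      inj₂ (o , refl , suc-injective (trans 1+j≡s+1+o (+-suc s o)))

    hasNeighbour : ∀ {o x} → o < L → position x ≡ s + o → 0 < deg G x
    hasNeighbour {o} o<L px with suc o <? L
    ... | yes 1+o<L = let y , py = vertexIn 1+o<L in
      represented-deg>0 rep (subst₂ (λ i j → adjacent cs i j ≡ true) (sym px) (sym py) (adjacent-inPath 1+o<L))
    hasNeighbour {zero}  o<L px | no 1≮L = ⊥-elim (1≮L 2≤L)
    hasNeighbour {suc o} o<L px | no _   = let y , py = vertexIn (<-trans (n<1+n o) o<L) in
      represented-deg>0 rep (subst₂ (λ i j → adjacent cs i j ≡ true) (sym px) (sym py) (adjacent-inPath⁻ o<L))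

    isLeaf : ∀ {o o′ v w} → position v ≡ s + o → position w ≡ s + o′ →
             adjacent cs (s + o) (s + o′) ≡ true →
             (∀ j → adjacent cs (s + o) j ≡ true → j ≡ s + o′) → deg G v ≡ 1
    isLeaf pv pw adj only rewrite sym pv | sym pw = represented-deg≡1 rep adj only

    leftEnd-isLeaf : ∀ {v} → position v ≡ s + 0 → deg G v ≡ 1
    leftEnd-isLeaf pv = let w , pw = vertexIn 2≤L in
      isLeaf pv pw (adjacent-inPath 2≤L) only
      where
      only : ∀ j → adjacent cs (s + 0) j ≡ true → j ≡ s + 1
      only j adj with neighbour-inPath (<-trans (s≤s z≤n) 2≤L) adj
      ... | inj₁ (_ , j≡) = j≡

    rightEnd-isLeaf : ∀ {o v} → suc (suc o) ≡ L → position v ≡ s + suc o → deg G v ≡ 1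
    rightEnd-isLeaf {o} refl pv = let w , pw = vertexIn (<-trans (n<1+n o) (n<1+n (suc o))) in
      isLeaf pv pw (adjacent-inPath⁻ (n<1+n (suc o))) only
      where
      only : ∀ j → adjacent cs (s + suc o) j ≡ true → j ≡ s + o
      only j adj with neighbour-inPath (n<1+n (suc o)) adj
      ... | inj₁ (2+o<2+o , _)      = ⊥-elim (<-irrefl refl 2+o<2+o)
      ... | inj₂ (_ , refl , j≡)    = j≡

    isolates : ∀ {o u v} → o < L → position u ≡ s + o → u ≢ v →
               (∀ j → adjacent cs (s + o) j ≡ true → j ≡ position v) → ¬ NoIsolated (delVertex G v)
    isolates {o} {u} {v} o<L pu u≢v only noIsolated =
      <-irrefl (sym (isolatedAfterDeleting rep only′)) (noIsolated u present-u)
      where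
      only′ : ∀ j → adjacent cs (position u) j ≡ true → j ≡ position v
      only′ = subst (λ i → ∀ j → adjacent cs i j ≡ true → j ≡ position v) (sym pu) only
      present-u : vert G u ∧ not (u =ᶠ v) ≡ true
      present-u rewrite vert≡ rep u | pu | present-inPath o<L | ≢⇒≡ᵇ-false (u≢v ∘ toℕ-injective) = refl

    nextToLeftEnd-isolates : ∀ {v} → position v ≡ s + 1 → ¬ NoIsolated (delVertex G v)
    nextToLeftEnd-isolates {v} pv = let u , pu = vertexIn (<-trans (s≤s z≤n) 2≤L) in
      isolates (<-trans (s≤s z≤n) 2≤L) pu (λ { refl → 1+n≢n (+-cancelˡ-≡ s _ _ (trans (sym pv) pu)) }) only
      where
      only : ∀ j → adjacent cs (s + 0) j ≡ true → j ≡ position v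
      only j adj with neighbour-inPath (<-trans (s≤s z≤n) 2≤L) adj
      ... | inj₁ (_ , j≡) = trans j≡ (sym pv)

    nextToRightEnd-isolates : ∀ {o v} → suc (suc o) ≡ L → position v ≡ s + o → ¬ NoIsolated (delVertex G v)
    nextToRightEnd-isolates {o} {v} refl pv = let u , pu = vertexIn (n<1+n (suc o)) in
      isolates (n<1+n (suc o)) pu (λ { refl → 1+n≢n (+-cancelˡ-≡ s _ _ (trans (sym pu) pv)) }) only
      where
      only : ∀ j → adjacent cs (s + suc o) j ≡ true → j ≡ position v
      only j adj with neighbour-inPath (n<1+n (suc o)) adj
      ... | inj₁ (2+o<2+o , _)   = ⊥-elim (<-irrefl refl 2+o<2+o)
      ... | inj₂ (_ , refl , j≡) = trans j≡ (sym pv)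

  wellFormed⇒noIsolated : ∀ {G xs} → WellFormed xs → Represents G xs → NoIsolated G
  wellFormed⇒noIsolated {xs = xs} wf rep x px with locate xs (trans (sym (vert≡ rep x)) px)
  ... | at pre L post o refl px≡ o<L = AtPath.hasNeighbour wf rep o<L px≡

  module SplitAt (pre : List Segment) (a c : ℕ) (post : List Segment) where

    old new : List Segment
    old = pre ++ path (2 + a + (3 + c)) ∷ post
    new = pre ++ path (2 + a) ∷ gap ∷ path (2 + c) ∷ post

    open DeleteVertexCells (cells pre ++ linkedCells (1 + a)) (pathCells (2 + c) ++ cells post)

    cells-old : cells old ≡ before
    cells-old = subst (λ L → cells (pre ++ path L ∷ post) ≡ before) (+-suc (1 + a) (3 + c))
                      (cells-splitPath pre (1 + a) (3 + c) post)

    cells-new : cells new ≡ after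
    cells-new = cells-endPath pre (1 + a) (gap ∷ path (2 + c) ∷ post)

    wellFormed-new : WellFormed old → WellFormed new
    wellFormed-new (wellFormed len adm) = wellFormed
      (trans (cong length cells-new)
        (trans length-after (trans (cong length (sym cells-old)) len)))
      (++⁺ (++⁻ˡ pre adm) (m≤m+n 2 a ∷ _ ∷ m≤m+n 2 c ∷ All.tail (++⁻ʳ pre adm)))

    represents-new : ∀ {G u} → Represents G old → position u ≡ length (cells pre) + (2 + a) →
                     Represents (delVertex G u) new
    represents-new {G} {u} rep pu = represents vert≡′ edge≡′
      where
      pu≡ : position u ≡ deleted
      pu≡ = trans pu (trans (+-suc (length (cells pre)) (1 + a)) (cong suc (sym (length-prefix pre (1 + a)))))
      g : ℕ → ℕ → Bool
      g i j = not (i ≡ᵇ deleted) ∧ not (j ≡ᵇ deleted)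
      vert≡′ : ∀ x → vert G x ∧ not (x =ᶠ u) ≡ present (cells new) (position x)
      vert≡′ x rewrite cells-new | present-after (position x) | vert≡ rep x | cells-old | =ᶠ-position x u | pu≡ = refl
      g-sym : ∀ i j → g i j ≡ g j i
      g-sym i j = ∧-comm (not (i ≡ᵇ deleted)) (not (j ≡ᵇ deleted))
      edge≡′ : ∀ x y → edge G x y ∧ not (x =ᶠ u) ∧ not (y =ᶠ u) ≡ adjacent (cells new) (position x) (position y)
      edge≡′ x y rewrite cells-new | adjacent-restrict before after g g-sym linked-after (position x) (position y)
                       | edge≡ rep x y | cells-old | =ᶠ-position x u | =ᶠ-position y u | pu≡ = refl

  module CutAt (pre : List Segment) (a c : ℕ) (post : List Segment) where

    old new : List Segment
    old = pre ++ path (2 + a + (2 + c)) ∷ post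
    new = pre ++ path (2 + a) ∷ path (2 + c) ∷ post

    open DeleteEdgeCells (cells pre ++ linkedCells (1 + a)) (pathCells (2 + c) ++ cells post)

    cells-old : cells old ≡ before
    cells-old = subst (λ L → cells (pre ++ path L ∷ post) ≡ before) (+-suc (1 + a) (2 + c))
                      (cells-splitPath pre (1 + a) (2 + c) post)

    cells-new : cells new ≡ after
    cells-new = cells-endPath pre (1 + a) (path (2 + c) ∷ post)

    wellFormed-new : WellFormed old → WellFormed new
    wellFormed-new (wellFormed len adm) = wellFormed
      (trans (cong length cells-new)
        (trans length-after (trans (cong length (sym cells-old)) len)))
      (++⁺ (++⁻ˡ pre adm) (m≤m+n 2 a ∷ m≤m+n 2 c ∷ All.tail (++⁻ʳ pre adm)))

    represents-new : ∀ {G x₀ y₀} → Represents G old → position x₀ ≡ length (cells pre) + (1 + a) →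
                     position y₀ ≡ suc (position x₀) → Represents (delEdge G x₀ y₀) new
    represents-new {G} {x₀} {y₀} rep px₀ py₀ = represents vert≡′ edge≡′
      where
      p : ℕ
      p = length (cells pre ++ linkedCells (1 + a))
      px₀≡ : position x₀ ≡ p
      px₀≡ = trans px₀ (sym (length-prefix pre (1 + a)))
      g : ℕ → ℕ → Bool
      g i j = not (((i ≡ᵇ p) ∧ (j ≡ᵇ suc p)) ∨ ((i ≡ᵇ suc p) ∧ (j ≡ᵇ p)))
      g-sym : ∀ i j → g i j ≡ g j i
      g-sym i j = cong not (trans (∨-comm ((i ≡ᵇ p) ∧ (j ≡ᵇ suc p)) ((i ≡ᵇ suc p) ∧ (j ≡ᵇ p)))
                                  (cong₂ _∨_ (∧-comm (i ≡ᵇ suc p) (j ≡ᵇ p)) (∧-comm (i ≡ᵇ p) (j ≡ᵇ suc p))))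
      linked-after′ : ∀ k → linked after k ≡ linked before k ∧ g k (suc k)
      linked-after′ k rewrite linked-after k with k ≟ p
      ... | yes refl rewrite ≡ᵇ-refl p = refl
      ... | no k≢p rewrite ≢⇒≡ᵇ-false k≢p with k ≟ suc p
      ...   | yes refl rewrite ≡ᵇ-refl p | ≢⇒≡ᵇ-false {suc (suc p)} {p} (m+1+n≢n 1) = refl
      ...   | no k≢1+p rewrite ≢⇒≡ᵇ-false k≢1+p = refl
      vert≡′ : ∀ x → vert G x ≡ present (cells new) (position x)
      vert≡′ x rewrite cells-new | present-after (position x) | vert≡ rep x | cells-old = refl
      edge≡′ : ∀ x y → edge G x y ∧ not ((x =ᶠ x₀ ∧ y =ᶠ y₀) ∨ (x =ᶠ y₀ ∧ y =ᶠ x₀))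
                       ≡ adjacent (cells new) (position x) (position y)
      edge≡′ x y rewrite cells-new | adjacent-restrict before after g g-sym linked-after′ (position x) (position y)
                       | edge≡ rep x y | cells-old | =ᶠ-position x x₀ | =ᶠ-position y y₀ | =ᶠ-position x y₀
                       | =ᶠ-position y x₀ | py₀ | px₀≡ = refl

  simulateLeft : ∀ {G xs v} → WellFormed xs → Represents G xs → LegalLeft G v →
                 ∃[ ys ] LeftSplit xs ys × WellFormed ys × Represents (delVertex G v) ys
  simulateLeft {xs = xs} {v} wf rep (present-v , notLeaf , noIsolated)
    with locate xs (trans (sym (vert≡ rep v)) present-v)
  ... | at pre L post o refl pv o<L with offsetView o<L
  ... | leftEnd          = ⊥-elim (notLeaf (AtPath.leftEnd-isLeaf wf rep pv))
  ... | nextToLeftEnd    = ⊥-elim (AtPath.nextToLeftEnd-isolates wf rep pv noIsolated)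
  ... | rightEnd a       = ⊥-elim (notLeaf (AtPath.rightEnd-isLeaf wf rep refl pv))
  ... | nextToRightEnd a = ⊥-elim (AtPath.nextToRightEnd-isolates wf rep refl pv noIsolated)
  ... | interior a c     = _ , leftSplit-at pre a c post , wellFormed-new wf , represents-new rep pv
    where open SplitAt pre a c post

  simulateRight : ∀ {G xs ys} → WellFormed xs → Represents G xs → RightCut xs ys →
                  ∃[ x ] ∃[ y ] LegalRight G x y × WellFormed ys × Represents (delEdge G x y) ys
  simulateRight {G} wf rep cut with rightCutAt cut
  ... | cutAt pre a c post =
    x₀ , y₀ , (edge-x₀y₀ , wellFormed⇒noIsolated wf′ rep′) , wf′ , rep′
    where
    open CutAt pre a c post
    open AtPath wf rep using (vertexIn; adjacent-inPath)
    2+a<L : 2 + a < 2 + a + (2 + c)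
    2+a<L = subst (2 + a <_) (sym (+-suc (2 + a) (1 + c))) (s≤s (m≤m+n (2 + a) (1 + c)))
    x₀ y₀ : Fin n
    x₀ = proj₁ (vertexIn (<-trans (n<1+n (1 + a)) 2+a<L))
    y₀ = proj₁ (vertexIn 2+a<L)
    px₀ : position x₀ ≡ length (cells pre) + (1 + a)
    px₀ = proj₂ (vertexIn (<-trans (n<1+n (1 + a)) 2+a<L))
    py₀′ : position y₀ ≡ length (cells pre) + (2 + a)
    py₀′ = proj₂ (vertexIn 2+a<L)
    py₀ : position y₀ ≡ suc (position x₀)
    py₀ = trans py₀′ (trans (+-suc _ (1 + a)) (cong suc (sym px₀)))
    wf′ : WellFormed new
    wf′ = wellFormed-new wf
    rep′ : Represents (delEdge G x₀ y₀) new
    rep′ = represents-new rep px₀ py₀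
    edge-x₀y₀ : edge G x₀ y₀ ≡ true
    edge-x₀y₀ = trans (edge≡ rep x₀ y₀)
      (subst₂ (λ i j → adjacent (cells old) i j ≡ true) (sym px₀) (sym py₀′) (adjacent-inPath 2+a<L))

  mutual
    simulateᴸ : ∀ {G xs} → WellFormed xs → Represents G xs → RightWinsᴸ xs → RightWinsLeftToMove G
    simulateᴸ wf rep (rightWinsᴸ reply) = rwL λ v legal →
      let ys , split , wf′ , rep′ = simulateLeft wf rep legal in simulateᴿ wf′ rep′ (reply split)

    simulateᴿ : ∀ {G xs} → WellFormed xs → Represents G xs → RightWinsᴿ xs → RightWinsRightToMove G
    simulateᴿ wf rep (rightWinsᴿ cut wins) =
      let x , y , legal , wf′ , rep′ = simulateRight wf rep cut in rwR x y legal (simulateᴸ wf′ rep′ wins)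

-- The first move

-- Numbering the cycle from the successor of v puts v last, so deleting v, or the edge from v
-- to its successor, leaves a path starting at position 0.
module OpeningAt (m : ℕ) (v : Fin (suc m)) where

  private
    successor : ∃[ u ] u < suc m × CyclicSucc (suc m) (toℕ v) u
    successor = cyclicSucc-exists (toℕ<n v)

    b : ℕ
    b = proj₁ successor

    b<n : b < suc m
    b<n = proj₁ (proj₂ successor)

  open Rotation (suc m) b b<n using (rotate-cyclicSucc; rotate-cyclicSucc⁻; rotate-above)
  open Representation (suc m) b b<n public

  position-v : position v ≡ m
  position-v with rotate-cyclicSucc (toℕ<n v) (proj₂ (proj₂ successor))
  ... | inj₁ e       = ⊥-elim (1+n≢0 (trans e (trans (rotate-above ≤-refl) (n∸n≡0 b))))
  ... | inj₂ (e , _) = suc-injective e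

  cycleAdj⇔ : ∀ x y → cycleAdj x y ≡ true ⇔ CyclicAdjacent (suc m) (position x) (position y)
  cycleAdj⇔ x y = mk⇔ to from
    where
    to : cycleAdj x y ≡ true → CyclicAdjacent (suc m) (position x) (position y)
    to adj with cycleAdj⇒cyclicSucc x y adj
    ... | inj₁ s = inj₁ (rotate-cyclicSucc (toℕ<n x) s)
    ... | inj₂ s = inj₂ (rotate-cyclicSucc (toℕ<n y) s)
    from : CyclicAdjacent (suc m) (position x) (position y) → cycleAdj x y ≡ true
    from (inj₁ s) = cyclicSucc⇒cycleAdj x y (inj₁ (rotate-cyclicSucc⁻ (toℕ<n x) (toℕ<n y) s))
    from (inj₂ s) = cyclicSucc⇒cycleAdj x y (inj₂ (rotate-cyclicSucc⁻ (toℕ<n y) (toℕ<n x) s))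

  private
    not-=ᶠv : ∀ x → not (x =ᶠ v) ≡ (position x <ᵇ m)
    not-=ᶠv x = trans (cong not (trans (=ᶠ-position x v) (cong (position x ≡ᵇ_) position-v)))
                      (not-≡ᵇ≡<ᵇ (position-< x))

  represents-deleteVertex : Represents (delVertex (C (suc m)) v) (path m ∷ gap ∷ [])
  represents-deleteVertex = represents vert≡ edge≡
    where
    cs : List Cell
    cs = cells (path m ∷ gap ∷ [])
    vert≡ : ∀ x → true ∧ not (x =ᶠ v) ≡ present cs (position x)
    vert≡ x = trans (not-=ᶠv x) (sym (cong proj₁ (cellAt-pathCells-gap m (position x))))
    edge≡ : ∀ x y → cycleAdj x y ∧ not (x =ᶠ v) ∧ not (y =ᶠ v) ≡ adjacent cs (position x) (position y)
    edge≡ x y = ⇔→≡ {z = true} (mk⇔ (from′ ∘ to) (from ∘ to′))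
      where
      open Equivalence
        (adjacent⇔pathAdjacent cs m (λ k → cong proj₂ (cellAt-pathCells-gap m k)) (position x) (position y))
        renaming (to to to′; from to from′)
      to : cycleAdj x y ∧ not (x =ᶠ v) ∧ not (y =ᶠ v) ≡ true → PathAdjacent m (position x) (position y)
      to h with ∧-true h
      ... | adj , nxy with ∧-true {not (x =ᶠ v)} nxy
      ... | nx , ny with cyclicAdjacent-cases (position-< x) (position-< y) (Equivalence.to (cycleAdj⇔ x y) adj)
      ... | inj₁ (inj₁ (e , _))    = inj₁ (e , <ᵇ-true⇒< (trans (sym (not-=ᶠv y)) ny))
      ... | inj₁ (inj₂ (e , _))    = inj₂ (e , <ᵇ-true⇒< (trans (sym (not-=ᶠv x)) nx))
      ... | inj₂ (inj₁ (i≡m , _))  = ⊥-elim (<-irrefl i≡m (<ᵇ-true⇒< (trans (sym (not-=ᶠv x)) nx)))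
      ... | inj₂ (inj₂ (j≡m , _))  = ⊥-elim (<-irrefl j≡m (<ᵇ-true⇒< (trans (sym (not-=ᶠv y)) ny)))
      from : PathAdjacent m (position x) (position y) → cycleAdj x y ∧ not (x =ᶠ v) ∧ not (y =ᶠ v) ≡ true
      from p = let i<m , j<m = pathAdjacent-< p in
        ∧-intro (Equivalence.from (cycleAdj⇔ x y) (pathAdjacent⇒cyclicAdjacent p))
                (∧-intro (trans (not-=ᶠv x) (<⇒<ᵇ-true i<m)) (trans (not-=ᶠv y) (<⇒<ᵇ-true j<m)))

  represents-deleteEdge : ∀ {w} → 2 ≤ m → position w ≡ 0 →
                          Represents (delEdge (C (suc m)) v w) (path (suc m) ∷ [])
  represents-deleteEdge {w} 2≤m pw = represents vert≡ edge≡
    where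
    cs : List Cell
    cs = cells (path (suc m) ∷ [])
    cellAt-cs : ∀ k → cellAt cs k ≡ ((k <ᵇ suc m) , (suc k <ᵇ suc m))
    cellAt-cs k = trans (cellAt-++-[] (pathCells (suc m)) k) (cellAt-pathCells (suc m) k)
    vert≡ : ∀ x → true ≡ present cs (position x)
    vert≡ x = sym (trans (cong proj₁ (cellAt-cs (position x))) (<⇒<ᵇ-true (position-< x)))
    wrapped : ℕ → ℕ → Bool
    wrapped i j = ((i ≡ᵇ m) ∧ (j ≡ᵇ 0)) ∨ ((i ≡ᵇ 0) ∧ (j ≡ᵇ m))
    wrapped≡ : ∀ x y → ((x =ᶠ v) ∧ (y =ᶠ w)) ∨ ((x =ᶠ w) ∧ (y =ᶠ v)) ≡ wrapped (position x) (position y)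
    wrapped≡ x y rewrite =ᶠ-position x v | =ᶠ-position y w | =ᶠ-position x w | =ᶠ-position y v
                       | position-v | pw = refl
    edge≡ : ∀ x y → cycleAdj x y ∧ not (((x =ᶠ v) ∧ (y =ᶠ w)) ∨ ((x =ᶠ w) ∧ (y =ᶠ v)))
                    ≡ adjacent cs (position x) (position y)
    edge≡ x y rewrite wrapped≡ x y = ⇔→≡ {z = true} (mk⇔ (from′ ∘ to) (from ∘ to′))
      where
      i j : ℕ
      i = position x
      j = position y
      open Equivalence (adjacent⇔pathAdjacent cs (suc m) (λ k → cong proj₂ (cellAt-cs k)) i j)
        renaming (to to to′; from to from′)
      to : cycleAdj x y ∧ not (wrapped i j) ≡ true → PathAdjacent (suc m) i j
      to h with ∧-true h
      ... | adj , nw with cyclicAdjacent-cases (position-< x) (position-< y) (Equivalence.to (cycleAdj⇔ x y) adj)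
      ... | inj₁ p                  = p
      ... | inj₂ (inj₁ (i≡m , j≡0)) =
        ⊥-elim (not-true⇒≢true nw (∨-introˡ _ (∧-intro (≡⇒≡ᵇ-true i≡m) (≡⇒≡ᵇ-true j≡0))))
      ... | inj₂ (inj₂ (j≡m , i≡0)) =
        ⊥-elim (not-true⇒≢true nw (∨-introʳ _ (∧-intro (≡⇒≡ᵇ-true i≡0) (≡⇒≡ᵇ-true j≡m))))
      from : PathAdjacent (suc m) i j → cycleAdj x y ∧ not (wrapped i j) ≡ true
      from p = ∧-intro (Equivalence.from (cycleAdj⇔ x y) (pathAdjacent⇒cyclicAdjacent p))
        (cong not (cong₂ _∨_
          (≡ᵇ∧≡ᵇ-false (pathAdjacent-notWrap 2≤m p))
          (≡ᵇ∧≡ᵇ-false (λ (i≡0 , j≡m) → pathAdjacent-notWrap 2≤m (pathAdjacent-sym p) (j≡m , i≡0)))))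

  wellFormed-deleteVertex : 2 ≤ m → WellFormed (path m ∷ gap ∷ [])
  wellFormed-deleteVertex 2≤m =
    wellFormed (trans (length-++ (pathCells m)) (trans (cong (_+ 1) (length-pathCells m)) (+-comm m 1)))
               (2≤m ∷ _ ∷ [])

  wellFormed-deleteEdge : 1 ≤ m → WellFormed (path (suc m) ∷ [])
  wellFormed-deleteEdge 1≤m =
    wellFormed (trans (length-++ (pathCells (suc m))) (trans (+-identityʳ _) (length-pathCells (suc m))))
               (s≤s 1≤m ∷ [])

rightWins-leftFirst : ∀ c → RightWinsLeftToMove (C (7 + c))
rightWins-leftFirst c = rwL λ v _ →
  let open OpeningAt (6 + c) v in
  simulateᴿ (wellFormed-deleteVertex (m≤m+n 2 (4 + c))) represents-deleteVertex (rightWinsᴿ-long c (gap ∷ []))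

rightWins-rightFirst : ∀ m → 8 ≤ suc m → suc m ≢ 11 → RightWinsRightToMove (C (suc m))
rightWins-rightFirst m 8≤n n≢11 =
  rwR v w (edge-vw , wellFormed⇒noIsolated wf rep) (simulateᴸ wf rep (rightWinsᴸ-path 8≤n n≢11))
  where
  v : Fin (suc m)
  v = Fin.zero
  open OpeningAt m v
  2≤m : 2 ≤ m
  2≤m = ≤-trans (s≤s (s≤s z≤n)) (s≤s⁻¹ 8≤n)
  w : Fin (suc m)
  w = proj₁ (vertexAt (s≤s z≤n))
  pw : position w ≡ 0
  pw = proj₂ (vertexAt (s≤s z≤n))
  wf : WellFormed (path (suc m) ∷ [])
  wf = wellFormed-deleteEdge (≤-trans (s≤s z≤n) 2≤m)
  rep : Represents (delEdge (C (suc m)) v w) (path (suc m) ∷ [])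
  rep = represents-deleteEdge 2≤m pw
  edge-vw : cycleAdj v w ≡ true
  edge-vw = Equivalence.from (cycleAdj⇔ v w) (inj₁ (inj₂ (cong suc position-v , pw)))

theorem3p12 : (n : ℕ) → 8 ≤ n → n ≢ 11 →
    RightWinsLeftToMove (C n) × RightWinsRightToMove (C n)
theorem3p12 n 8≤n n≢11 with m≤n⇒∃[o]m+o≡n 8≤n
... | c , refl = rightWins-leftFirst (suc c) , rightWins-rightFirst (7 + c) 8≤n n≢11
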